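{- Let $f:\{0,1\}^n\to\{0,1\}$, let $b$ be a positive integer, and define $F:\{0,1\}^{nb}\to\{0,1\}$ by \[F(x)=f\left(\bigoplus_{i=1}^{b}x_i,\ \bigoplus_{i=b+1}^{2b}x_i,\ \dots,\ \bigoplus_{i=nb-b+1}^{nb}x_i\right).\] Then for any $k\le n$, $\mathrm{dist}(F,\mathcal{J}_{kb})=\mathrm{dist}(F,\mathcal{J}_{kb+b-1})=\mathrm{dist}(f,\mathcal{J}_k)$.
   Context: $\mathcal{J}_m$ denotes the class of $m$-juntas (functions depending on at most $m$ variables) on the relevant domain, and $\mathrm{dist}(f,\mathcal{J}_m)=\min_{g\in\mathcal{J}_m}\Pr_x[f(x)\ne g(x)]$ for uniform $x$. -}

module Defs where

open import Data.Bool using (Bool; true; false; _xor_; if_then_else_)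
open import Data.Nat using (ℕ; zero; suc; _+_; _*_; _≤_)
open import Data.Fin using (Fin; combine)
open import Data.Fin.Subset using (Subset; _∈_; ∣_∣)
open import Data.Vec using (Vec; []; _∷_; lookup; tabulate; foldr)
open import Data.List using (List; []; _∷_; map; _++_)
open import Data.Nat.ListAction using (sum)
open import Data.Product using (Σ; _×_; _,_)
open import Relation.Binary.PropositionalEquality using (_≡_)

allVecs : (n : ℕ) → List (Vec Bool n)
allVecs zero = [] ∷ []
allVecs (suc n) = map (false ∷_) (allVecs n) ++ map (true ∷_) (allVecs n)

disagree : {n : ℕ} → (Vec Bool n → Bool) → (Vec Bool n → Bool) → ℕ
disagree {n} f g = sum (map (λ x → if f x xor g x then 1 else 0) (allVecs n))

IsJunta : {n : ℕ} → ℕ → (Vec Bool n → Bool) → Set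
IsJunta {n} m g =
  Σ (Subset n) λ S → ∣ S ∣ ≤ m ×
    ((x y : Vec Bool n) → ((i : Fin n) → i ∈ S → lookup x i ≡ lookup y i) → g x ≡ g y)

-- d = 2^n * dist(f, J_m): d is the minimum number of disagreements with an m-junta
IsDistCount : {n : ℕ} → (Vec Bool n → Bool) → ℕ → ℕ → Set
IsDistCount {n} f m d =
  (Σ (Vec Bool n → Bool) λ g → IsJunta m g × disagree f g ≡ d) ×
  ((g : Vec Bool n → Bool) → IsJunta m g → d ≤ disagree f g)

-- XOR of the j-th block (coordinates j*b, ..., j*b + b - 1, 0-indexed)
blockXor : {n b : ℕ} → Vec Bool (n * b) → Fin n → Bool
blockXor {n} {b} x j = foldr (λ _ → Bool) _xor_ false (tabulate {n = b} (λ t → lookup x (combine j t)))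

liftXor : {n : ℕ} (b : ℕ) → (Vec Bool n → Bool) → Vec Bool (n * b) → Bool
liftXor {n} b f x = f (tabulate (blockXor {n} {b} x))

-- Fix in every block a pivot coordinate.  A point of {0,1}^(nb) is then
-- determined by its vector y of block parities and by its n(b-1) non-pivot
-- bits z, and F depends only on y; hence for every G the disagreement of F
-- and G is the sum over z of the disagreement of f and y ↦ G(y, z).  If G
-- depends only on a set T with |T| ≤ kb + b - 1, choose each pivot outside T
-- whenever the block is not contained in T: at most k blocks lie inside T, and
-- for fixed z the slice y ↦ G(y, z) depends only on those blocks, so it is a
-- k-junta and every slice costs at least 2^n dist(f, J_k).  Conversely,
-- composing an optimal k-junta h for f with the block parities gives a
-- kb-junta attaining this bound.
module Submission where

open import Defs
open import Data.Bool using (Bool; true; false; _xor_; _∧_; if_then_else_)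
open import Data.Bool.Properties using (xor-assoc; xor-comm; xor-same; xor-identityʳ)
open import Data.Nat using (ℕ; zero; suc; _+_; _*_; _∸_; _^_; _≤_; z≤n; s≤s; s≤s⁻¹; _≤?_)
open import Data.Nat.Properties
open import Data.Fin using (Fin; zero; suc; combine)
import Data.Fin.Properties as Fin
open import Data.Fin.Subset using (Subset; _∈_; ∣_∣; ⊥)
open import Data.Fin.Subset.Properties using (∣⊤∣≡n; ∣⊥∣≡0)
open import Data.Vec using (Vec; []; _∷_; lookup; tabulate; foldr; insertAt; replicate; concat; _++_; take; drop; here; there)
import Data.Vec as Vec
open import Data.Vec.Properties using (take++drop≡id; ++-injective; tabulate-cong; tabulate∘lookup; lookup∘tabulate; lookup-++ˡ; lookup-++ʳ; lookup-concat; lookup-map; lookup-replicate; []=⇒lookup; lookup⇒[]=)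
open import Data.List using (List; map; concatMap; cartesianProductWith)
open import Data.List.Relation.Unary.Any as Any using (Any)
open import Data.List.Relation.Unary.Any.Properties using (map⁺; ++⁺ˡ; ++⁺ʳ; concatMap⁺; cartesianProductWith⁺)
open import Data.List.Relation.Unary.All using (lookupWith)
open import Data.List.Extrema.Nat using (argmin; f[argmin]≤f[xs])
import Data.List as List
open import Data.List.Properties using (map-++; map-∘; map-cong)
open import Data.Nat.ListAction using (sum)
open import Data.Nat.ListAction.Properties using (sum-++)
open import Data.Product using (Σ; _×_; _,_; proj₁; proj₂)
open import Function using (_∘_)
open import Algebra.Properties.CommutativeSemigroup +-commutativeSemigroup using (interchange)
open import Data.Empty using (⊥-elim)
open import Relation.Nullary using (yes; no)
open import Relation.Binary.PropositionalEquality

cubeSum : (n : ℕ) → (Vec Bool n → ℕ) → ℕ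
cubeSum n h = sum (map h (allVecs n))

cubeSum-suc : ∀ n (h : Vec Bool (suc n) → ℕ) →
  cubeSum (suc n) h ≡ cubeSum n (h ∘ (false ∷_)) + cubeSum n (h ∘ (true ∷_))
cubeSum-suc n h = begin
    sum (map h (map (false ∷_) xs List.++ map (true ∷_) xs))
  ≡⟨ cong sum (map-++ h (map (false ∷_) xs) (map (true ∷_) xs)) ⟩
    sum (map h (map (false ∷_) xs) List.++ map h (map (true ∷_) xs))
  ≡⟨ sum-++ (map h (map (false ∷_) xs)) _ ⟩
    sum (map h (map (false ∷_) xs)) + sum (map h (map (true ∷_) xs))
  ≡⟨ sym (cong₂ _+_ (cong sum (map-∘ xs)) (cong sum (map-∘ xs))) ⟩
    cubeSum n (h ∘ (false ∷_)) + cubeSum n (h ∘ (true ∷_))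
  ∎
  where
  open ≡-Reasoning
  xs = allVecs n

cubeSum-cong : ∀ n {h h′ : Vec Bool n → ℕ} → (∀ x → h x ≡ h′ x) → cubeSum n h ≡ cubeSum n h′
cubeSum-cong n h≗h′ = cong sum (map-cong h≗h′ (allVecs n))

cubeSum-mono : ∀ n {h h′ : Vec Bool n → ℕ} → (∀ x → h x ≤ h′ x) → cubeSum n h ≤ cubeSum n h′
cubeSum-mono zero h≤h′ = +-monoˡ-≤ 0 (h≤h′ [])
cubeSum-mono (suc n) {h} {h′} h≤h′ = begin
    cubeSum (suc n) h
  ≡⟨ cubeSum-suc n h ⟩
    cubeSum n (h ∘ (false ∷_)) + cubeSum n (h ∘ (true ∷_))
  ≤⟨ +-mono-≤ (cubeSum-mono n (h≤h′ ∘ (false ∷_))) (cubeSum-mono n (h≤h′ ∘ (true ∷_))) ⟩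
    cubeSum n (h′ ∘ (false ∷_)) + cubeSum n (h′ ∘ (true ∷_))
  ≡⟨ cubeSum-suc n h′ ⟨
    cubeSum (suc n) h′
  ∎
  where open ≤-Reasoning

cubeSum-+ : ∀ n (h h′ : Vec Bool n → ℕ) → cubeSum n (λ x → h x + h′ x) ≡ cubeSum n h + cubeSum n h′
cubeSum-+ zero h h′ = sym (interchange (h []) 0 (h′ []) 0)
cubeSum-+ (suc n) h h′ = begin
    cubeSum (suc n) (λ x → h x + h′ x)
  ≡⟨ cubeSum-suc n _ ⟩
    cubeSum n (λ x → h (false ∷ x) + h′ (false ∷ x)) + cubeSum n (λ x → h (true ∷ x) + h′ (true ∷ x))
  ≡⟨ cong₂ _+_ (cubeSum-+ n _ _) (cubeSum-+ n _ _) ⟩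
    (cubeSum n (h ∘ (false ∷_)) + cubeSum n (h′ ∘ (false ∷_))) + (cubeSum n (h ∘ (true ∷_)) + cubeSum n (h′ ∘ (true ∷_)))
  ≡⟨ interchange (cubeSum n (h ∘ (false ∷_))) (cubeSum n (h′ ∘ (false ∷_))) (cubeSum n (h ∘ (true ∷_))) (cubeSum n (h′ ∘ (true ∷_))) ⟩
    (cubeSum n (h ∘ (false ∷_)) + cubeSum n (h ∘ (true ∷_))) + (cubeSum n (h′ ∘ (false ∷_)) + cubeSum n (h′ ∘ (true ∷_)))
  ≡⟨ cong₂ _+_ (cubeSum-suc n h) (cubeSum-suc n h′) ⟨
    cubeSum (suc n) h + cubeSum (suc n) h′
  ∎
  where open ≡-Reasoning

cubeSum-const : ∀ n d → cubeSum n (λ _ → d) ≡ 2 ^ n * d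
cubeSum-const zero d = trans (+-identityʳ d) (sym (+-identityʳ d))
cubeSum-const (suc n) d = begin
    cubeSum (suc n) (λ _ → d)
  ≡⟨ cubeSum-suc n _ ⟩
    cubeSum n (λ _ → d) + cubeSum n (λ _ → d)
  ≡⟨ cong₂ _+_ (cubeSum-const n d) (cubeSum-const n d) ⟩
    2 ^ n * d + 2 ^ n * d
  ≡⟨ *-distribʳ-+ d (2 ^ n) (2 ^ n) ⟨
    (2 ^ n + 2 ^ n) * d
  ≡⟨ cong (λ t → (2 ^ n + t) * d) (+-identityʳ (2 ^ n)) ⟨
    2 ^ suc n * d
  ∎
  where open ≡-Reasoning

cubeSum-++ : ∀ m p (h : Vec Bool (m + p) → ℕ) →
  cubeSum (m + p) h ≡ cubeSum m (λ xs → cubeSum p (λ ys → h (xs ++ ys)))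
cubeSum-++ zero p h = sym (+-identityʳ _)
cubeSum-++ (suc m) p h = begin
    cubeSum (suc m + p) h
  ≡⟨ cubeSum-suc (m + p) h ⟩
    cubeSum (m + p) (h ∘ (false ∷_)) + cubeSum (m + p) (h ∘ (true ∷_))
  ≡⟨ cong₂ _+_ (cubeSum-++ m p _) (cubeSum-++ m p _) ⟩
    cubeSum m (λ xs → cubeSum p (λ ys → h (false ∷ xs ++ ys))) + cubeSum m (λ xs → cubeSum p (λ ys → h (true ∷ xs ++ ys)))
  ≡⟨ cubeSum-suc m _ ⟨
    cubeSum (suc m) (λ xs → cubeSum p (λ ys → h (xs ++ ys)))
  ∎
  where open ≡-Reasoning

cubeSum-insertAt : ∀ n (i : Fin (suc n)) (h : Vec Bool (suc n) → ℕ) →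
  cubeSum (suc n) h ≡ cubeSum n (λ w → h (insertAt w i false) + h (insertAt w i true))
cubeSum-insertAt n zero h = trans (cubeSum-suc n h) (sym (cubeSum-+ n _ _))
cubeSum-insertAt (suc n) (suc i) h = begin
    cubeSum (suc (suc n)) h
  ≡⟨ cubeSum-suc (suc n) h ⟩
    cubeSum (suc n) (h ∘ (false ∷_)) + cubeSum (suc n) (h ∘ (true ∷_))
  ≡⟨ cong₂ _+_ (cubeSum-insertAt n i _) (cubeSum-insertAt n i _) ⟩
    cubeSum n (λ w → h (false ∷ insertAt w i false) + h (false ∷ insertAt w i true))
      + cubeSum n (λ w → h (true ∷ insertAt w i false) + h (true ∷ insertAt w i true))
  ≡⟨ cubeSum-suc n _ ⟨
    cubeSum (suc n) (λ w → h (insertAt w (suc i) false) + h (insertAt w (suc i) true))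
  ∎
  where open ≡-Reasoning

parity : ∀ {n} → Vec Bool n → Bool
parity = foldr (λ _ → Bool) _xor_ false

parity-insertAt : ∀ {n} (w : Vec Bool n) i v → parity (insertAt w i v) ≡ v xor parity w
parity-insertAt w zero v = refl
parity-insertAt (x ∷ w) (suc i) v = begin
    x xor parity (insertAt w i v)
  ≡⟨ cong (x xor_) (parity-insertAt w i v) ⟩
    x xor (v xor parity w)
  ≡⟨ xor-assoc x v (parity w) ⟨
    (x xor v) xor parity w
  ≡⟨ cong (_xor parity w) (xor-comm x v) ⟩
    (v xor x) xor parity w
  ≡⟨ xor-assoc v x (parity w) ⟩
    v xor (x xor parity w)
  ∎
  where open ≡-Reasoning

withParity : ∀ {c} → Fin (suc c) → Bool → Vec Bool c → Vec Bool (suc c)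
withParity i y w = insertAt w i (y xor parity w)

parity-withParity : ∀ {c} (i : Fin (suc c)) y w → parity (withParity i y w) ≡ y
parity-withParity i y w = begin
    parity (insertAt w i (y xor parity w))
  ≡⟨ parity-insertAt w i (y xor parity w) ⟩
    (y xor parity w) xor parity w
  ≡⟨ xor-assoc y (parity w) (parity w) ⟩
    y xor (parity w xor parity w)
  ≡⟨ cong (y xor_) (xor-same (parity w)) ⟩
    y xor false
  ≡⟨ xor-identityʳ y ⟩
    y
  ∎
  where open ≡-Reasoning

cubeSum-withParity : ∀ c (i : Fin (suc c)) (h : Vec Bool (suc c) → ℕ) →
  cubeSum (suc c) h ≡ cubeSum c (λ w → h (withParity i false w) + h (withParity i true w))
cubeSum-withParity c i h = trans (cubeSum-insertAt c i h) (cubeSum-cong c swap-if-odd)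
  where
  swap-if-odd : ∀ w → h (insertAt w i false) + h (insertAt w i true)
                    ≡ h (withParity i false w) + h (withParity i true w)
  swap-if-odd w with parity w
  ... | false = refl
  ... | true = +-comm (h (insertAt w i false)) (h (insertAt w i true))

take-++ : ∀ {A : Set} {m p} (xs : Vec A m) (ys : Vec A p) → take m (xs ++ ys) ≡ xs
take-++ {m = m} xs ys = proj₁ (++-injective _ xs (take++drop≡id m (xs ++ ys)))

drop-++ : ∀ {A : Set} {m p} (xs : Vec A m) (ys : Vec A p) → drop m (xs ++ ys) ≡ ys
drop-++ {m = m} xs ys = proj₂ (++-injective _ xs (take++drop≡id m (xs ++ ys)))

fromParities : ∀ {n c} → Vec (Fin (suc c)) n → Vec Bool n → Vec Bool (n * c) → Vec Bool (n * suc c)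
fromParities [] [] z = []
fromParities {c = c} (i ∷ is) (y ∷ ys) z = withParity i y (take c z) ++ fromParities is ys (drop c z)

fromParities-++ : ∀ {n c} i (is : Vec (Fin (suc c)) n) y ys (w : Vec Bool c) z →
  fromParities (i ∷ is) (y ∷ ys) (w ++ z) ≡ withParity i y w ++ fromParities is ys z
fromParities-++ i is y ys w z =
  cong₂ (λ w′ z′ → withParity i y w′ ++ fromParities is ys z′) (take-++ w z) (drop-++ w z)

cubeSum-fromParities : ∀ n c (is : Vec (Fin (suc c)) n) (h : Vec Bool (n * suc c) → ℕ) →
  cubeSum (n * suc c) h ≡ cubeSum (n * c) (λ z → cubeSum n (λ y → h (fromParities is y z)))
cubeSum-fromParities zero c [] h = sym (+-identityʳ _)
cubeSum-fromParities (suc n) c (i ∷ is) h = begin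
    cubeSum (suc c + n * suc c) h
  ≡⟨ cubeSum-++ (suc c) (n * suc c) h ⟩
    cubeSum (suc c) (λ xs → cubeSum (n * suc c) (λ r → h (xs ++ r)))
  ≡⟨ cubeSum-cong (suc c) (λ xs → cubeSum-fromParities n c is (λ r → h (xs ++ r))) ⟩
    cubeSum (suc c) inner
  ≡⟨ cubeSum-withParity c i inner ⟩
    cubeSum c (λ w → inner (withParity i false w) + inner (withParity i true w))
  ≡⟨ cubeSum-cong c (λ w → sym (split-first-parity w)) ⟩
    cubeSum c (λ w → cubeSum (n * c) (λ z → cubeSum (suc n) (λ y → h (fromParities (i ∷ is) y (w ++ z)))))
  ≡⟨ cubeSum-++ c (n * c) _ ⟨
    cubeSum (c + n * c) (λ z → cubeSum (suc n) (λ y → h (fromParities (i ∷ is) y z)))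
  ∎
  where
  open ≡-Reasoning
  inner : Vec Bool (suc c) → ℕ
  inner xs = cubeSum (n * c) (λ z → cubeSum n (λ ys → h (xs ++ fromParities is ys z)))
  split-first-parity : ∀ w →
    cubeSum (n * c) (λ z → cubeSum (suc n) (λ y → h (fromParities (i ∷ is) y (w ++ z))))
      ≡ inner (withParity i false w) + inner (withParity i true w)
  split-first-parity w = begin
      cubeSum (n * c) (λ z → cubeSum (suc n) (λ y → h (fromParities (i ∷ is) y (w ++ z))))
    ≡⟨ cubeSum-cong (n * c) (λ z → trans (cubeSum-suc n _) (cong₂ _+_
         (cubeSum-cong n (λ ys → cong h (fromParities-++ i is false ys w z)))
         (cubeSum-cong n (λ ys → cong h (fromParities-++ i is true ys w z))))) ⟩
      cubeSum (n * c) (λ z → cubeSum n (λ ys → h (withParity i false w ++ fromParities is ys z))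
                           + cubeSum n (λ ys → h (withParity i true w ++ fromParities is ys z)))
    ≡⟨ cubeSum-+ (n * c) _ _ ⟩
      inner (withParity i false w) + inner (withParity i true w)
    ∎

blockXor-zero-++ : ∀ {n b} (xs : Vec Bool b) (ys : Vec Bool (n * b)) →
  blockXor {suc n} {b} (xs ++ ys) zero ≡ parity xs
blockXor-zero-++ xs ys = cong parity (trans (tabulate-cong (lookup-++ˡ xs ys)) (tabulate∘lookup xs))

blockXor-suc-++ : ∀ {n b} (xs : Vec Bool b) (ys : Vec Bool (n * b)) j →
  blockXor {suc n} {b} (xs ++ ys) (suc j) ≡ blockXor ys j
blockXor-suc-++ {n} xs ys j = cong parity (tabulate-cong (λ t → lookup-++ʳ xs ys (combine j t)))

blockXor-fromParities : ∀ {n c} (is : Vec (Fin (suc c)) n) y z →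
  tabulate (blockXor {n} {suc c} (fromParities is y z)) ≡ y
blockXor-fromParities [] [] z = refl
blockXor-fromParities {suc n} {c} (i ∷ is) (y ∷ ys) z = cong₂ _∷_
  (trans (blockXor-zero-++ {n} block rest) (parity-withParity i y (take c z)))
  (trans (tabulate-cong (blockXor-suc-++ {n} block rest)) (blockXor-fromParities is ys (drop c z)))
  where
  block : Vec Bool (suc c)
  block = withParity i y (take c z)
  rest : Vec Bool (n * suc c)
  rest = fromParities is ys (drop c z)

liftXor-fromParities : ∀ {n c} (f : Vec Bool n → Bool) is y z → liftXor (suc c) f (fromParities is y z) ≡ f y
liftXor-fromParities f is y z = cong f (blockXor-fromParities is y z)

disagree-liftXor≡cubeSum : ∀ {n} c (f : Vec Bool n → Bool) (G : Vec Bool (n * suc c) → Bool) is →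
  disagree (liftXor (suc c) f) G ≡ cubeSum (n * c) (λ z → disagree f (λ y → G (fromParities is y z)))
disagree-liftXor≡cubeSum {n} c f G is = trans (cubeSum-fromParities n c is _)
  (cubeSum-cong (n * c) (λ z → cubeSum-cong n (λ y →
    cong (λ t → if t xor G (fromParities is y z) then 1 else 0) (liftXor-fromParities f is y z))))

Agree : ∀ {n} → Subset n → Vec Bool n → Vec Bool n → Set
Agree {n} S x y = (i : Fin n) → i ∈ S → lookup x i ≡ lookup y i

DependsOnlyOn : ∀ {n} → Subset n → (Vec Bool n → Bool) → Set
DependsOnlyOn {n} S g = (x y : Vec Bool n) → Agree S x y → g x ≡ g y

Agree-++ : ∀ {m p} {A : Subset m} {B : Subset p} {x x′ u u′} →
  Agree A x x′ → Agree B u u′ → Agree (A ++ B) (x ++ u) (x′ ++ u′)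
Agree-++ {A = []} {x = []} {[]} _ u≈u′ i i∈B = u≈u′ i i∈B
Agree-++ {A = _ ∷ _} {x = _ ∷ _} {_ ∷ _} x≈x′ _ zero here = x≈x′ zero here
Agree-++ {A = _ ∷ _} {x = _ ∷ x} {_ ∷ x′} {u} {u′} x≈x′ u≈u′ (suc i) (there i∈) =
  Agree-++ {x = x} {x′} {u} {u′} (λ j j∈ → x≈x′ (suc j) (there j∈)) u≈u′ i i∈

lookup-insertAt-≢ : ∀ {A : Set} {c} (w : Vec A c) {i j : Fin (suc c)} v v′ → j ≢ i →
  lookup (insertAt w i v) j ≡ lookup (insertAt w i v′) j
lookup-insertAt-≢ w {zero} {zero} v v′ j≢i = ⊥-elim (j≢i refl)
lookup-insertAt-≢ w {zero} {suc j} v v′ j≢i = refl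
lookup-insertAt-≢ (x ∷ w) {suc i} {zero} v v′ j≢i = refl
lookup-insertAt-≢ (x ∷ w) {suc i} {suc j} v v′ j≢i = lookup-insertAt-≢ w v v′ (j≢i ∘ cong suc)

withParity-agree : ∀ {c} (T : Subset (suc c)) i y y′ (w : Vec Bool c) →
  (i ∈ T → y ≡ y′) → Agree T (withParity i y w) (withParity i y′ w)
withParity-agree T i y y′ w i∈T⇒y≡y′ j j∈T with j Fin.≟ i
... | yes refl = cong (λ t → lookup (withParity i t w) i) (i∈T⇒y≡y′ j∈T)
... | no j≢i = lookup-insertAt-≢ w _ _ j≢i

pivot : ∀ {c} → Subset (suc c) → Fin (suc c)
pivot (false ∷ _) = zero
pivot {zero} (true ∷ []) = zero
pivot {suc c} (true ∷ T) = suc (pivot T)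

pivot∈⇒full : ∀ {c} (T : Subset (suc c)) → pivot T ∈ T → ∣ T ∣ ≡ suc c
pivot∈⇒full {zero} (true ∷ []) _ = refl
pivot∈⇒full {suc c} (true ∷ T) (there p∈T) = cong suc (pivot∈⇒full T p∈T)

pivots : ∀ n {c} → Subset (n * suc c) → Vec (Fin (suc c)) n
pivots zero _ = []
pivots (suc n) {c} T = pivot (take (suc c) T) ∷ pivots n (drop (suc c) T)

fullBlocks : ∀ n {c} → Subset (n * suc c) → Subset n
fullBlocks zero _ = []
fullBlocks (suc n) {c} T = lookup T₀ (pivot T₀) ∷ fullBlocks n (drop (suc c) T)
  where
  T₀ : Subset (suc c)
  T₀ = take (suc c) T

Agree-fromParities : ∀ n {c} (T : Subset (n * suc c)) y y′ (z : Vec Bool (n * c)) →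
  Agree (fullBlocks n T) y y′ →
  Agree T (fromParities (pivots n T) y z) (fromParities (pivots n T) y′ z)
Agree-fromParities zero T [] [] z _ ()
Agree-fromParities (suc n) {c} T (y ∷ ys) (y′ ∷ ys′) z y≈y′ =
  subst (λ T′ → Agree T′ (fromParities (pivots (suc n) T) (y ∷ ys) z) (fromParities (pivots (suc n) T) (y′ ∷ ys′) z))
    (take++drop≡id (suc c) T)
    (Agree-++ {x = withParity (pivot T₀) y (take c z)} {withParity (pivot T₀) y′ (take c z)}
       (withParity-agree T₀ (pivot T₀) y y′ (take c z)
          (λ p∈T₀ → y≈y′ zero (lookup⇒[]= zero (fullBlocks (suc n) T) ([]=⇒lookup p∈T₀))))
       (Agree-fromParities n (drop (suc c) T) ys ys′ (drop c z) (λ j j∈ → y≈y′ (suc j) (there j∈))))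
  where
  T₀ : Subset (suc c)
  T₀ = take (suc c) T

∣++∣ : ∀ {m p} (A : Subset m) (B : Subset p) → ∣ A ++ B ∣ ≡ ∣ A ∣ + ∣ B ∣
∣++∣ [] B = refl
∣++∣ (true ∷ A) B = cong suc (∣++∣ A B)
∣++∣ (false ∷ A) B = ∣++∣ A B

∣fullBlocks∣*b≤∣T∣ : ∀ n {c} (T : Subset (n * suc c)) → ∣ fullBlocks n T ∣ * suc c ≤ ∣ T ∣
∣fullBlocks∣*b≤∣T∣ zero T = z≤n
∣fullBlocks∣*b≤∣T∣ (suc n) {c} T = begin
    ∣ fullBlocks (suc n) T ∣ * suc c
  ≤⟨ first-block (lookup T₀ (pivot T₀)) refl ⟩
    ∣ T₀ ∣ + ∣ T′ ∣
  ≡⟨ trans (sym (∣++∣ T₀ T′)) (cong ∣_∣ (take++drop≡id (suc c) T)) ⟩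
    ∣ T ∣
  ∎
  where
  open ≤-Reasoning
  T₀ : Subset (suc c)
  T₀ = take (suc c) T
  T′ : Subset (n * suc c)
  T′ = drop (suc c) T
  first-block : ∀ s → lookup T₀ (pivot T₀) ≡ s → ∣ s ∷ fullBlocks n T′ ∣ * suc c ≤ ∣ T₀ ∣ + ∣ T′ ∣
  first-block true p∈T₀ = subst (λ t → suc c + ∣ fullBlocks n T′ ∣ * suc c ≤ t + ∣ T′ ∣)
    (sym (pivot∈⇒full T₀ (lookup⇒[]= _ T₀ p∈T₀))) (+-monoʳ-≤ (suc c) (∣fullBlocks∣*b≤∣T∣ n T′))
  first-block false _ = ≤-trans (∣fullBlocks∣*b≤∣T∣ n T′) (m≤n+m ∣ T′ ∣ ∣ T₀ ∣)

m*b≤k*b+b∸1⇒m≤k : ∀ m k c → m * suc c ≤ k * suc c + suc c ∸ 1 → m ≤ k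
m*b≤k*b+b∸1⇒m≤k m k c m*b≤ = s≤s⁻¹ (*-cancelʳ-< (suc c) m (suc k) (begin-strict
    m * suc c
  ≤⟨ m*b≤ ⟩
    k * suc c + suc c ∸ 1
  ≡⟨ +-∸-assoc (k * suc c) (s≤s z≤n) ⟩
    k * suc c + c
  <⟨ +-monoʳ-< (k * suc c) (n<1+n c) ⟩
    k * suc c + suc c
  ≡⟨ +-comm (k * suc c) (suc c) ⟩
    suc k * suc c
  ∎))
  where open ≤-Reasoning

restriction-isJunta : ∀ {n} c k (G : Vec Bool (n * suc c) → Bool) (T : Subset (n * suc c)) →
  ∣ T ∣ ≤ k * suc c + suc c ∸ 1 → DependsOnlyOn T G →
  ∀ z → IsJunta k (λ y → G (fromParities (pivots n T) y z))
restriction-isJunta {n} c k G T ∣T∣≤ G-on-T z =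
  fullBlocks n T ,
  m*b≤k*b+b∸1⇒m≤k ∣ fullBlocks n T ∣ k c (≤-trans (∣fullBlocks∣*b≤∣T∣ n T) ∣T∣≤) ,
  λ y y′ y≈y′ → G-on-T _ _ (Agree-fromParities n T y y′ z y≈y′)

n*b∸n≡n*c : ∀ n c → n * suc c ∸ n ≡ n * c
n*b∸n≡n*c n c = trans (cong (_∸ n) (*-suc n c)) (m+n∸m≡n n (n * c))

disagree-liftXor-≥ : ∀ {n} c k (f : Vec Bool n → Bool) d →
  ((g : Vec Bool n → Bool) → IsJunta k g → d ≤ disagree f g) →
  (G : Vec Bool (n * suc c) → Bool) → IsJunta (k * suc c + suc c ∸ 1) G →
  d * 2 ^ (n * suc c ∸ n) ≤ disagree (liftXor (suc c) f) G
disagree-liftXor-≥ {n} c k f d d≤ G (T , ∣T∣≤ , G-on-T) = begin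
    d * 2 ^ (n * suc c ∸ n)
  ≡⟨ cong (λ e → d * 2 ^ e) (n*b∸n≡n*c n c) ⟩
    d * 2 ^ (n * c)
  ≡⟨ trans (*-comm d _) (sym (cubeSum-const (n * c) d)) ⟩
    cubeSum (n * c) (λ _ → d)
  ≤⟨ cubeSum-mono (n * c) (λ z → d≤ _ (restriction-isJunta c k G T ∣T∣≤ G-on-T z)) ⟩
    cubeSum (n * c) (λ z → disagree f (λ y → G (fromParities (pivots n T) y z)))
  ≡⟨ disagree-liftXor≡cubeSum c f G (pivots n T) ⟨
    disagree (liftXor (suc c) f) G
  ∎
  where open ≤-Reasoning

expand : ∀ {n} b → Subset n → Subset (n * b)
expand b S = concat (Vec.map (replicate b) S)

∣expand∣ : ∀ {n} b (S : Subset n) → ∣ expand b S ∣ ≡ ∣ S ∣ * b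
∣expand∣ b [] = refl
∣expand∣ b (true ∷ S) = trans (∣++∣ (replicate b true) (expand b S)) (cong₂ _+_ (∣⊤∣≡n b) (∣expand∣ b S))
∣expand∣ b (false ∷ S) =
  trans (∣++∣ (replicate b false) (expand b S)) (cong₂ _+_ (∣⊥∣≡0 b) (∣expand∣ b S))


∈-expand : ∀ {n} b (S : Subset n) {j} t → j ∈ S → combine j t ∈ expand b S
∈-expand b S {j} t j∈S = lookup⇒[]= (combine j t) (expand b S) (begin
    lookup (concat (Vec.map (replicate b) S)) (combine j t)
  ≡⟨ lookup-concat (Vec.map (replicate b) S) j t ⟩
    lookup (lookup (Vec.map (replicate b) S) j) t
  ≡⟨ cong (λ v → lookup v t) (lookup-map j (replicate b) S) ⟩
    lookup (replicate b (lookup S j)) t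
  ≡⟨ lookup-replicate t (lookup S j) ⟩
    lookup S j
  ≡⟨ []=⇒lookup j∈S ⟩
    true
  ∎)
  where open ≡-Reasoning

liftXor-isJunta : ∀ {n} b k (h : Vec Bool n → Bool) → IsJunta k h → IsJunta (k * b) (liftXor b h)
liftXor-isJunta b k h (S , ∣S∣≤k , h-on-S) =
  expand b S ,
  subst (_≤ k * b) (sym (∣expand∣ b S)) (*-monoˡ-≤ b ∣S∣≤k) ,
  λ x x′ x≈x′ → h-on-S _ _ (λ j j∈S → begin
      lookup (tabulate (blockXor x)) j
    ≡⟨ lookup∘tabulate (blockXor x) j ⟩
      parity (tabulate (λ t → lookup x (combine j t)))
    ≡⟨ cong parity (tabulate-cong (λ t → x≈x′ (combine j t) (∈-expand b S t j∈S))) ⟩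
      parity (tabulate (λ t → lookup x′ (combine j t)))
    ≡⟨ lookup∘tabulate (blockXor x′) j ⟨
      lookup (tabulate (blockXor x′)) j
    ∎)
  where open ≡-Reasoning

disagree-liftXor-liftXor : ∀ {n} c (f h : Vec Bool n → Bool) →
  disagree (liftXor (suc c) f) (liftXor (suc c) h) ≡ disagree f h * 2 ^ (n * suc c ∸ n)
disagree-liftXor-liftXor {n} c f h = begin
    disagree (liftXor (suc c) f) (liftXor (suc c) h)
  ≡⟨ disagree-liftXor≡cubeSum c f (liftXor (suc c) h) is ⟩
    cubeSum (n * c) (λ z → disagree f (λ y → liftXor (suc c) h (fromParities is y z)))
  ≡⟨ cubeSum-cong (n * c) (λ z → cubeSum-cong n (λ y →
       cong (λ t → if f y xor t then 1 else 0) (liftXor-fromParities h is y z))) ⟩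
    cubeSum (n * c) (λ _ → disagree f h)
  ≡⟨ trans (cubeSum-const (n * c) _) (*-comm (2 ^ (n * c)) _) ⟩
    disagree f h * 2 ^ (n * c)
  ≡⟨ cong (λ e → disagree f h * 2 ^ e) (n*b∸n≡n*c n c) ⟨
    disagree f h * 2 ^ (n * suc c ∸ n)
  ∎
  where
  open ≡-Reasoning
  is : Vec (Fin (suc c)) n
  is = replicate n zero

disagree-congʳ : ∀ {n} (f : Vec Bool n → Bool) {g h} → (∀ x → g x ≡ h x) → disagree f g ≡ disagree f h
disagree-congʳ {n} f g≗h = cubeSum-cong n (λ x → cong (λ t → if f x xor t then 1 else 0) (g≗h x))

allVecs-complete : ∀ {n} (x : Vec Bool n) → Any (x ≡_) (allVecs n)
allVecs-complete [] = Any.here refl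
allVecs-complete (false ∷ x) = ++⁺ˡ (map⁺ (Any.map (cong (false ∷_)) (allVecs-complete x)))
allVecs-complete {suc n} (true ∷ x) =
  ++⁺ʳ (map (false ∷_) (allVecs n)) (map⁺ (Any.map (cong (true ∷_)) (allVecs-complete x)))

allFunctions : ∀ n → List (Vec Bool n → Bool)
allFunctions zero = (λ _ → false) List.∷ (λ _ → true) List.∷ List.[]
allFunctions (suc n) = cartesianProductWith branch (allFunctions n) (allFunctions n)
  where
  branch : (Vec Bool n → Bool) → (Vec Bool n → Bool) → Vec Bool (suc n) → Bool
  branch g₀ g₁ (b ∷ x) = if b then g₁ x else g₀ x

allFunctions-complete : ∀ n (g : Vec Bool n → Bool) → Any (λ h → ∀ x → g x ≡ h x) (allFunctions n)
allFunctions-complete zero g with g [] in eq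
... | false = Any.here (λ { [] → eq })
... | true = Any.there (Any.here (λ { [] → eq }))
allFunctions-complete (suc n) g =
  cartesianProductWith⁺ _ (λ g₀ g₁ → λ { (false ∷ x) → g₀ x ; (true ∷ x) → g₁ x })
    (allFunctions-complete n (g ∘ (false ∷_))) (allFunctions-complete n (g ∘ (true ∷_)))

mask : ∀ {n} → Subset n → Vec Bool n → Vec Bool n
mask S x = tabulate (λ i → lookup S i ∧ lookup x i)

mask-agree : ∀ {n} (S : Subset n) x y → Agree S x y → mask S x ≡ mask S y
mask-agree S x y x≈y = tabulate-cong masked
  where
  masked : ∀ i → lookup S i ∧ lookup x i ≡ lookup S i ∧ lookup y i
  masked i with lookup S i in i∈S
  ... | true = x≈y i (lookup⇒[]= i S i∈S)
  ... | false = refl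

agree-mask : ∀ {n} (S : Subset n) x → Agree S x (mask S x)
agree-mask S x i i∈S = sym (trans (lookup∘tabulate _ i) (cong (_∧ lookup x i) ([]=⇒lookup i∈S)))

Junta : ℕ → ℕ → Set
Junta n k = Σ (Vec Bool n → Bool) (IsJunta k)

juntasOn : ∀ {n} k (S : Subset n) → List (Junta n k)
juntasOn {n} k S with ∣ S ∣ ≤? k
... | yes ∣S∣≤k = map (λ t → t ∘ mask S , S , ∣S∣≤k , λ x y x≈y → cong t (mask-agree S x y x≈y)) (allFunctions n)
... | no _ = List.[]

juntasOn-complete : ∀ {n} k (S : Subset n) g → ∣ S ∣ ≤ k → DependsOnlyOn S g →
  Any (λ h → ∀ x → g x ≡ proj₁ h x) (juntasOn k S)
juntasOn-complete {n} k S g ∣S∣≤k g-on-S with ∣ S ∣ ≤? k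
... | yes _ = map⁺ (Any.map (λ g≗t x → trans (g-on-S x (mask S x) (agree-mask S x)) (g≗t (mask S x)))
                            (allFunctions-complete n g))
... | no ∣S∣≰k = ⊥-elim (∣S∣≰k ∣S∣≤k)

juntas : ∀ n k → List (Junta n k)
juntas n k = concatMap (juntasOn k) (allVecs n)

juntas-complete : ∀ n k g → IsJunta k g → Any (λ h → ∀ x → g x ≡ proj₁ h x) (juntas n k)
juntas-complete n k g (S , ∣S∣≤k , g-on-S) = concatMap⁺ (juntasOn k) (Any.map
  (λ S≡S′ → subst (λ S′ → Any _ (juntasOn k S′)) S≡S′ (juntasOn-complete k S g ∣S∣≤k g-on-S))
  (allVecs-complete S))

isDistCount-exists : ∀ n k (f : Vec Bool n → Bool) → Σ ℕ (IsDistCount f k)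
isDistCount-exists n k f = cost best , (proj₁ best , proj₂ best , refl) , minimal
  where
  cost : Junta n k → ℕ
  cost (g , _) = disagree f g
  constant : Junta n k
  constant = (λ _ → false) , ⊥ , subst (_≤ k) (sym (∣⊥∣≡0 n)) z≤n , λ _ _ _ → refl
  best : Junta n k
  best = argmin cost constant (juntas n k)
  minimal : (g : Vec Bool n → Bool) → IsJunta k g → cost best ≤ disagree f g
  minimal g g-junta = lookupWith (λ best≤h g≗h → ≤-trans best≤h (≤-reflexive (sym (disagree-congʳ f g≗h))))
    (f[argmin]≤f[xs] constant (juntas n k)) (juntas-complete n k g g-junta)

IsJunta-weaken : ∀ {n m m′} {g : Vec Bool n → Bool} → m ≤ m′ → IsJunta m g → IsJunta m′ g
IsJunta-weaken m≤m′ (S , ∣S∣≤m , g-on-S) = S , ≤-trans ∣S∣≤m m≤m′ , g-on-S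

lemma11 : (n b k : ℕ) (f : Vec Bool n → Bool) → 1 ≤ b → k ≤ n →
    Σ ℕ λ d →
    IsDistCount f k d ×
    IsDistCount (liftXor b f) (k * b) (d * 2 ^ (n * b ∸ n)) ×
    IsDistCount (liftXor b f) (k * b + b ∸ 1) (d * 2 ^ (n * b ∸ n))
lemma11 n zero k f () _
lemma11 n (suc c) k f _ _ with isDistCount-exists n k f
... | d , d-is-dist@((h , h-junta , refl) , d-minimal) =
  d , d-is-dist ,
  ((F-h , F-h-junta , F-h-count) , λ G → lower G ∘ IsJunta-weaken kb≤) ,
  ((F-h , IsJunta-weaken kb≤ F-h-junta , F-h-count) , lower)
  where
  F-h : Vec Bool (n * suc c) → Bool
  F-h = liftXor (suc c) h
  F-h-junta : IsJunta (k * suc c) F-h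
  F-h-junta = liftXor-isJunta (suc c) k h h-junta
  F-h-count : disagree (liftXor (suc c) f) F-h ≡ d * 2 ^ (n * suc c ∸ n)
  F-h-count = disagree-liftXor-liftXor c f h
  lower : ∀ G → IsJunta (k * suc c + suc c ∸ 1) G → d * 2 ^ (n * suc c ∸ n) ≤ disagree (liftXor (suc c) f) G
  lower = disagree-liftXor-≥ c k f d d-minimal
  kb≤ : k * suc c ≤ k * suc c + suc c ∸ 1
  kb≤ = ≤-trans (m≤m+n (k * suc c) c) (≤-reflexive (sym (+-∸-assoc (k * suc c) (s≤s z≤n))))
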